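{- The structure $(\mathbb{Z},<)$ has the property $\mathsf{EHomDef}(\mathsf{WMSO{+}B})$.
   Context: For a $\{<\}$-structure $\mathcal{B}=(B,J)$, a homomorphism to $(\mathbb{Z},<)$ is a map $h:B\to\mathbb{Z}$ with $h(b_1)<h(b_2)$ whenever $(b_1,b_2)\in J(<)$; write $\mathcal{B}\preceq(\mathbb{Z},<)$ if one exists. $\mathsf{WMSO}$ is monadic second-order logic with set variables ranging only over finite sets; $\mathsf{WMSO{+}B}$ adds the bounding quantifier: $\mathcal{A}\models\mathsf{B}X\colon\phi(X)$ iff there is $b\in\mathbb{N}$ with $|F|\le b$ for every finite $F$ with $\mathcal{A}\models\phi(F)$. A structure $\mathcal{A}$ over signature $\mathcal{S}$ has property $\mathsf{EHomDef}(\mathcal{L})$ if there is a computable function mapping each finite $\sigma\subseteq\mathcal{S}$ to an $\mathcal{L}$-sentence $\varphi_\sigma$ over $\sigma$ such that for every countable $\sigma$-structure $\mathcal{B}$: $\mathcal{B}\preceq\mathcal{A}$ iff $\mathcal{B}\models\varphi_\sigma$ (homomorphisms preserving the relations in $\sigma$). -}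

module Defs where

open import Data.Nat using (ℕ; zero; suc; _≤_)
open import Data.Bool using (Bool; T)
open import Data.Unit using (⊤)
open import Data.Fin using (Fin)
open import Data.List using (List; length)
open import Data.List.Relation.Unary.Unique.Propositional using (Unique)
open import Data.List.Membership.Propositional using (_∈_)
open import Data.Product using (proj₁; Σ; Σ-syntax; ∃; _×_; _,_)
open import Data.Sum using (_⊎_)
open import Data.Integer using (ℤ) renaming (_<_ to _<ℤ_)
open import Data.Vec.Functional using (Vector; _∷_)
open import Function.Definitions using (Injective)
open import Function.Bundles using (_⇔_)
open import Relation.Binary.PropositionalEquality using (_≡_)
open import Relation.Nullary using (¬_; Dec)

-- Relational signatures (all symbols binary, which suffices for {<}).
-- A signature is a type of symbols; a sub-signature σ ⊆ S is given by
-- its characteristic function S → Bool.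

SubSig : Set → Set
SubSig S = S → Bool

Sym : {S : Set} → SubSig S → Set
Sym {S} σ = Σ S (λ s → T (σ s))

record Structure (Symb : Set) : Set₁ where
  field
    Carrier : Set
    rel     : Symb → Carrier → Carrier → Set
open Structure public

-- countable = injects into ℕ (includes finite and empty structures)
Countable : {Symb : Set} → Structure Symb → Set
Countable 𝔅 = Σ (Carrier 𝔅 → ℕ) (Injective _≡_ _≡_)

reduct : {S : Set} (σ : SubSig S) → Structure S → Structure (Sym σ)
reduct σ 𝔄 = record { Carrier = Carrier 𝔄 ; rel = λ s → rel 𝔄 (proj₁ s) }

_⪯_ : {Symb : Set} → Structure Symb → Structure Symb → Set
𝔅 ⪯ 𝔄 = Σ (Carrier 𝔅 → Carrier 𝔄)
           (λ h → ∀ s b₁ b₂ → rel 𝔅 s b₁ b₂ → rel 𝔄 s (h b₁) (h b₂))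

-- WMSO+B syntax over a symbol type, de Bruijn indices:
-- n first-order variables, m (finite-)set variables.

data Fml (Symb : Set) : ℕ → ℕ → Set where
  atom  : ∀ {n m} → Symb → Fin n → Fin n → Fml Symb n m
  eq    : ∀ {n m} → Fin n → Fin n → Fml Symb n m
  mem   : ∀ {n m} → Fin n → Fin m → Fml Symb n m
  not   : ∀ {n m} → Fml Symb n m → Fml Symb n m
  and   : ∀ {n m} → Fml Symb n m → Fml Symb n m → Fml Symb n m
  or    : ∀ {n m} → Fml Symb n m → Fml Symb n m → Fml Symb n m
  ex₁   : ∀ {n m} → Fml Symb (suc n) m → Fml Symb n m
  all₁  : ∀ {n m} → Fml Symb (suc n) m → Fml Symb n m
  ex₂   : ∀ {n m} → Fml Symb n (suc m) → Fml Symb n m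
  all₂  : ∀ {n m} → Fml Symb n (suc m) → Fml Symb n m
  bnd   : ∀ {n m} → Fml Symb n (suc m) → Fml Symb n m

Sentence : Set → Set
Sentence Symb = Fml Symb 0 0

FinSet : Set → Set
FinSet D = Σ (List D) Unique

card : {D : Set} → FinSet D → ℕ
card (xs , _) = length xs

_∈ₛ_ : {D : Set} → D → FinSet D → Set
x ∈ₛ (xs , _) = x ∈ xs

-- satisfaction (set-valued; classical reading obtained via LEM hypothesis)
⟦_⟧ : {Symb : Set} {n m : ℕ} → Fml Symb n m → (𝔄 : Structure Symb) →
      Vector (Carrier 𝔄) n → Vector (FinSet (Carrier 𝔄)) m → Set
⟦ atom s i j ⟧ 𝔄 ρ η = rel 𝔄 s (ρ i) (ρ j)
⟦ eq i j ⟧    𝔄 ρ η = ρ i ≡ ρ j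
⟦ mem i X ⟧   𝔄 ρ η = ρ i ∈ₛ η X
⟦ not φ ⟧     𝔄 ρ η = ¬ ⟦ φ ⟧ 𝔄 ρ η
⟦ and φ ψ ⟧   𝔄 ρ η = ⟦ φ ⟧ 𝔄 ρ η × ⟦ ψ ⟧ 𝔄 ρ η
⟦ or φ ψ ⟧    𝔄 ρ η = ⟦ φ ⟧ 𝔄 ρ η ⊎ ⟦ ψ ⟧ 𝔄 ρ η
⟦ ex₁ φ ⟧     𝔄 ρ η = Σ (Carrier 𝔄) (λ a → ⟦ φ ⟧ 𝔄 (a ∷ ρ) η)
⟦ all₁ φ ⟧    𝔄 ρ η = (a : Carrier 𝔄) → ⟦ φ ⟧ 𝔄 (a ∷ ρ) η
⟦ ex₂ φ ⟧     𝔄 ρ η = Σ (FinSet (Carrier 𝔄)) (λ F → ⟦ φ ⟧ 𝔄 ρ (F ∷ η))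
⟦ all₂ φ ⟧    𝔄 ρ η = (F : FinSet (Carrier 𝔄)) → ⟦ φ ⟧ 𝔄 ρ (F ∷ η)
⟦ bnd φ ⟧     𝔄 ρ η = Σ ℕ (λ b → (F : FinSet (Carrier 𝔄)) →
                         ⟦ φ ⟧ 𝔄 ρ (F ∷ η) → card F ≤ b)

_⊨_ : {Symb : Set} → Structure Symb → Sentence Symb → Set
𝔄 ⊨ φ = ⟦ φ ⟧ 𝔄 (λ ()) (λ ())

LEM : Set₁
LEM = (P : Set) → Dec P

-- EHomDef(WMSO+B): an (Agda-definable, hence computable) map from
-- sub-signatures to sentences defining homomorphic-map-ability to 𝔄
-- among countable structures.  (Every σ ⊆ S is finite when S is.)
EHomDef-WMSOB : {S : Set} → Structure S → Set₁
EHomDef-WMSOB {S} 𝔄 =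
  Σ ((σ : SubSig S) → Sentence (Sym σ)) λ φ →
    LEM → (σ : SubSig S) (𝔅 : Structure (Sym σ)) → Countable 𝔅 →
      (𝔅 ⪯ reduct σ 𝔄) ⇔ (𝔅 ⊨ φ σ)

ℤ< : Structure ⊤
ℤ< = record { Carrier = ℤ ; rel = λ _ → _<ℤ_ }

-- A countable digraph E maps strictly monotonically into (ℤ,<) iff it has no cycle and
-- between any two vertices x, y the chains of vertices lying on walks from x to y have
-- bounded size. Both conditions are weak MSO+B expressible: reachability inside a finite
-- set is weak MSO, and the second condition is one bounding quantifier. Necessity: a
-- monotone h squeezes such a chain injectively into the interval [h x, h y]. Sufficiency:
-- the conditions bound the lengths of walks between any two vertices, and one enumerates
-- the vertices, giving each one a value above every placed predecessor (shifted by the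
-- longest walk to it) and below every placed successor; the earlier choices make the
-- two requirements compatible.
module Submission where

open import Defs
open import Data.Bool.Properties using (T?; T-irrelevant)
open import Data.Empty using (⊥-elim)
open import Data.Fin using (Fin; zero; suc; fromℕ<)
open import Data.Fin.Properties using (pigeonhole; fromℕ<-injective) renaming (<⇒≢ to <⇒≢ᶠ)
open import Data.Integer using (ℤ; +_; -_; 0ℤ; _+_; _-_; ∣_∣; +≤+)
  renaming (_≤_ to _≤ℤ_; _<_ to _<ℤ_; _≥_ to _≥ℤ_; _≤?_ to _≤ℤ?_; _<?_ to _<ℤ?_)
import Data.Integer.Properties as ℤ
open import Algebra.Properties.AbelianGroup ℤ.+-0-abelianGroup using (//-rightDividesˡ; ∙-cancelʳ)
open import Data.List using (List; []; _∷_; length; lookup; filter; deduplicate)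
open import Data.List.Membership.Propositional using (_∈_)
open import Data.List.Membership.Propositional.Properties
  using (∈-lookup; ∈-filter⁺; ∈-filter⁻; ∈-deduplicate⁺)
open import Data.List.Relation.Unary.All as All using ([])
open import Data.List.Relation.Unary.All.Properties using (¬Any⇒All¬)
open import Data.List.Relation.Unary.AllPairs using ([]; _∷_)
open import Data.List.Relation.Unary.Any using (here; there)
open import Data.List.Relation.Unary.Unique.Propositional using (Unique)
open import Data.List.Relation.Unary.Unique.Propositional.Properties using (filter⁺)
import Data.List.Relation.Unary.Unique.DecPropositional.Properties as UniqueDec
open import Data.Nat using (ℕ; zero; suc; _≤_; _<_; s≤s; s≤s⁻¹; _≟_) renaming (_+_ to _+ℕ_)
open import Data.Nat.Properties
  using (_≤?_; ≰⇒>; n≮0; ≤∧≢⇒<; <⇒≢; m<n⇒m<1+n; m<1+n⇒m<n∨m≡n; m≤m+n; m≤n+m; n<1+n)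
open import Data.Product using (Σ; ∃; ∃-syntax; _×_; _,_; proj₁; proj₂)
open import Data.Sum using (_⊎_; inj₁; inj₂; [_,_]; map₂)
open import Data.Unit using (⊤; tt)
open import Function using (_∘_)
open import Function.Bundles using (_⇔_; mk⇔)
open import Function.Definitions using (Injective)
import Function.Properties.Equivalence as ⇔
open import Level using (0ℓ)
open import Relation.Binary.Core using (Rel; _Preserves_⟶_)
open import Relation.Binary.Definitions using (Transitive; Total)
import Relation.Binary.Construct.Flip.EqAndOrd as Flip
open import Relation.Binary.PropositionalEquality
  using (_≡_; _≢_; refl; sym; trans; cong; subst; subst₂)
open import Relation.Nullary using (¬_; Dec; yes; no)
open import Relation.Nullary.Decidable using (decidable-stable; map′)
open import Relation.Unary using (Pred; Empty; _∪_; _≐_)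

lookup-injective : ∀ {A : Set} {xs : List A} → Unique xs →
                   ∀ i j → lookup xs i ≡ lookup xs j → i ≡ j
lookup-injective (_ ∷ _)         zero    zero    _ = refl
lookup-injective (x∉xs ∷ _)      zero    (suc j) e = ⊥-elim (All.lookup x∉xs (∈-lookup j) e)
lookup-injective (x∉xs ∷ _)      (suc i) zero    e = ⊥-elim (All.lookup x∉xs (∈-lookup i) (sym e))
lookup-injective (_ ∷ unique-xs) (suc i) (suc j) e = cong suc (lookup-injective unique-xs i j e)

length≤-of-injection : ∀ {A : Set} {xs : List A} {n} → Unique xs → (f : A → ℕ) →
                       (∀ {x} → x ∈ xs → f x < n) →
                       (∀ {x y} → x ∈ xs → y ∈ xs → f x ≡ f y → x ≡ y) →
                       length xs ≤ n
length≤-of-injection {xs = xs} {n} unique f f<n f-injective with length xs ≤? n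
... | yes |xs|≤n = |xs|≤n
... | no |xs|≰n with pigeonhole (≰⇒> |xs|≰n) (λ i → fromℕ< (f<n (∈-lookup i)))
... | i , j , i<j , fi≡fj = ⊥-elim (<⇒≢ᶠ i<j (lookup-injective unique i j
        (f-injective (∈-lookup i) (∈-lookup j) (fromℕ<-injective _ _ _ _ fi≡fj))))

length≤-of-injection-into-interval :
  ∀ {A : Set} {xs : List A} {lo hi} → Unique xs → (f : A → ℤ) →
  (∀ {x} → x ∈ xs → lo ≤ℤ f x × f x ≤ℤ hi) →
  (∀ {x y} → x ∈ xs → y ∈ xs → f x ≡ f y → x ≡ y) →
  length xs ≤ suc ∣ lo - hi ∣
length≤-of-injection-into-interval {lo = lo} {hi} unique f bounds f-injective =
  length≤-of-injection unique distance distance-bounded distance-injective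
  where
  distance : _ → ℕ
  distance x = ∣ lo - f x ∣

  distance≡ : ∀ {x} → lo ≤ℤ f x → + distance x ≡ f x - lo
  distance≡ = ℤ.∣-∣-≤

  distance-bounded : ∀ {x} → x ∈ _ → distance x < suc ∣ lo - hi ∣
  distance-bounded x∈xs with bounds x∈xs
  ... | lo≤fx , fx≤hi = s≤s (ℤ.drop‿+≤+ (subst₂ _≤ℤ_ (sym (distance≡ lo≤fx))
                          (sym (ℤ.∣-∣-≤ (ℤ.≤-trans lo≤fx fx≤hi)))
                          (ℤ.+-monoˡ-≤ (- lo) fx≤hi)))

  distance-injective : ∀ {x y} → x ∈ _ → y ∈ _ → distance x ≡ distance y → x ≡ y
  distance-injective x∈xs y∈xs e = f-injective x∈xs y∈xs (∙-cancelʳ (- lo) _ _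
    (trans (sym (distance≡ (proj₁ (bounds x∈xs))))
      (trans (cong +_ e) (distance≡ (proj₁ (bounds y∈xs))))))

data GreatestOrEmpty {A : Set} (_≼_ : Rel A 0ℓ) (P : Pred A 0ℓ) : Set where
  greatest : ∀ m → P m → (∀ {z} → P z → z ≼ m) → GreatestOrEmpty _≼_ P
  empty    : Empty P → GreatestOrEmpty _≼_ P

module _ {A : Set} {_≼_ : Rel A 0ℓ} where

  greatestOrEmpty-≐ : ∀ {P Q} → P ≐ Q → GreatestOrEmpty _≼_ P → GreatestOrEmpty _≼_ Q
  greatestOrEmpty-≐ (P⊆Q , Q⊆P) (greatest m pm max) = greatest m (P⊆Q pm) (max ∘ Q⊆P)
  greatestOrEmpty-≐ (P⊆Q , Q⊆P) (empty none)       = empty (λ z → none z ∘ Q⊆P)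

  greatestOrEmpty-∪ : Transitive _≼_ → Total _≼_ → ∀ {P Q} →
                      GreatestOrEmpty _≼_ P → GreatestOrEmpty _≼_ Q → GreatestOrEmpty _≼_ (P ∪ Q)
  greatestOrEmpty-∪ _ _ (empty ¬P) (empty ¬Q) = empty (λ z → [ ¬P z , ¬Q z ])
  greatestOrEmpty-∪ _ _ (greatest m pm maxP) (empty ¬Q) =
    greatest m (inj₁ pm) [ maxP , ⊥-elim ∘ ¬Q _ ]
  greatestOrEmpty-∪ _ _ (empty ¬P) (greatest m qm maxQ) =
    greatest m (inj₂ qm) [ ⊥-elim ∘ ¬P _ , maxQ ]
  greatestOrEmpty-∪ ≼-trans ≼-total (greatest m pm maxP) (greatest m′ qm′ maxQ)
    with ≼-total m m′
  ... | inj₁ m≼m′ = greatest m′ (inj₂ qm′) [ (λ p → ≼-trans (maxP p) m≼m′) , maxQ ]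
  ... | inj₂ m′≼m = greatest m (inj₁ pm) [ maxP , (λ q → ≼-trans (maxQ q) m′≼m) ]

greatestOrEmpty-image : ∀ {A C : Set} {_≼_ : Rel A 0ℓ} {_⊑_ : Rel C 0ℓ} {P : Pred A 0ℓ} →
                        (f : A → C) → f Preserves _≼_ ⟶ _⊑_ → GreatestOrEmpty _≼_ P →
                        GreatestOrEmpty _⊑_ (λ z → ∃[ a ] P a × f a ≡ z)
greatestOrEmpty-image f mono (greatest m pm max) =
  greatest (f m) (m , pm , refl) λ { (_ , pa , refl) → mono (max pa) }
greatestOrEmpty-image f mono (empty none) = empty (λ _ (a , pa , _) → none a pa)

greatestOrEmpty-bounded : LEM → ∀ {P : Pred ℕ 0ℓ} N → (∀ {k} → P k → k < N) →
                          GreatestOrEmpty _≤_ P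
greatestOrEmpty-bounded lem zero bounded = empty (λ _ → n≮0 ∘ bounded)
greatestOrEmpty-bounded lem {P} (suc N) bounded with lem (P N)
... | yes pN = greatest N pN (s≤s⁻¹ ∘ bounded)
... | no ¬pN = greatestOrEmpty-bounded lem N
      (λ pk → ≤∧≢⇒< (s≤s⁻¹ (bounded pk)) (λ { refl → ¬pN pk }))

module Digraph {B : Set} (E : B → B → Set) where

  infixr 5 _◅_ _◅◅_

  data Walk : B → B → ℕ → Set where
    ε   : ∀ {x} → Walk x x 0
    _◅_ : ∀ {x y z k} → E x y → Walk y z k → Walk x z (suc k)

  Walk⁺ : B → B → Set
  Walk⁺ x y = ∃[ k ] Walk x y (suc k)

  _◅◅_ : ∀ {x y z k l} → Walk x y k → Walk y z l → Walk x z (k +ℕ l)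
  ε       ◅◅ w′ = w′
  (e ◅ w) ◅◅ w′ = e ◅ (w ◅◅ w′)

  Acyclic : Set
  Acyclic = ∀ {x} → ¬ Walk⁺ x x

  closed-walk-length : Acyclic → ∀ {x k} → Walk x x k → k ≡ 0
  closed-walk-length acyclic ε       = refl
  closed-walk-length acyclic (e ◅ w) = ⊥-elim (acyclic (_ , e ◅ w))

  vertices : ∀ {x y k} → Walk x y k → List B
  vertices {x} ε       = x ∷ []
  vertices {x} (_ ◅ w) = x ∷ vertices w

  length-vertices : ∀ {x y k} (w : Walk x y k) → length (vertices w) ≡ suc k
  length-vertices ε       = refl
  length-vertices (_ ◅ w) = cong suc (length-vertices w)

  split-at : ∀ {x y z k} (w : Walk x y k) → z ∈ vertices w → ∃ (Walk x z) × ∃ (Walk z y)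
  split-at ε       (here refl) = (_ , ε) , (_ , ε)
  split-at (e ◅ w) (here refl) = (_ , ε) , (_ , e ◅ w)
  split-at (e ◅ w) (there z∈w) with split-at w z∈w
  ... | (_ , w₁) , w₂ = (_ , e ◅ w₁) , w₂

  source∈vertices : ∀ {x y k} (w : Walk x y k) → x ∈ vertices w
  source∈vertices ε       = here refl
  source∈vertices (_ ◅ _) = here refl

  vertices-unique : Acyclic → ∀ {x y k} (w : Walk x y k) → Unique (vertices w)
  vertices-unique acyclic ε       = [] ∷ []
  vertices-unique acyclic (e ◅ w) =
    ¬Any⇒All¬ _ (λ x∈w → acyclic (_ , e ◅ proj₂ (proj₁ (split-at w x∈w))))
    ∷ vertices-unique acyclic w

  vertices-comparable : ∀ {x y k p q} (w : Walk x y k) → p ∈ vertices w → q ∈ vertices w →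
                        p ≡ q ⊎ Walk⁺ p q ⊎ Walk⁺ q p
  vertices-comparable ε       (here refl) (here refl) = inj₁ refl
  vertices-comparable (e ◅ w) (here refl) (here refl) = inj₁ refl
  vertices-comparable (e ◅ w) (here refl) (there q∈w) =
    inj₂ (inj₁ (_ , e ◅ proj₂ (proj₁ (split-at w q∈w))))
  vertices-comparable (e ◅ w) (there p∈w) (here refl) =
    inj₂ (inj₂ (_ , e ◅ proj₂ (proj₁ (split-at w p∈w))))
  vertices-comparable (e ◅ w) (there p∈w) (there q∈w) = vertices-comparable w p∈w q∈w

  ExitEdge : FinSet B → FinSet B → Set
  ExitEdge Y Z = Σ B λ a → Σ B λ b → a ∈ₛ Y × b ∈ₛ Z × ¬ b ∈ₛ Y × E a b

  -- Reachability inside a finite Z, expressed without walks: every Y ∋ u that no edge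
  -- leaves within Z contains v.
  Reach : B → B → Set
  Reach u v = Σ (FinSet B) λ Z → u ∈ₛ Z ×
                ((Y : FinSet B) → ¬ (u ∈ₛ Y × ¬ v ∈ₛ Y × ¬ ExitEdge Y Z))

  Reach⁺ : B → B → Set
  Reach⁺ u v = Σ B λ w → E u w × Reach w v

  -- The semantics of the defining sentence; the ¬ (… × ¬ …) shapes come from the
  -- formula syntax, which has no implication.
  NoCycle : Set
  NoCycle = (u v : B) → ¬ (E u v × Reach v u)

  Chain : FinSet B → Set
  Chain X = (p q : B) → ¬ (p ∈ₛ X × q ∈ₛ X × ¬ (p ≡ q ⊎ Reach⁺ p q ⊎ Reach⁺ q p))

  Between : B → B → FinSet B → Set
  Between x y X = (p : B) → ¬ (p ∈ₛ X × ¬ (Reach x p × Reach p y))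

  BoundedIntervals : Set
  BoundedIntervals = (x y : B) → Σ ℕ λ b → (X : FinSet B) → Chain X × Between x y X → card X ≤ b

  module _ (lem : LEM) where

    exit-edge : ∀ {x y k} (w : Walk x y k) (Y Z : FinSet B) →
                (∀ {z} → z ∈ vertices w → z ∈ₛ Z) → x ∈ₛ Y → ¬ y ∈ₛ Y → ExitEdge Y Z
    exit-edge ε              Y Z w⊆Z x∈Y x∉Y = ⊥-elim (x∉Y x∈Y)
    exit-edge (_◅_ {y = y} e w) Y Z w⊆Z x∈Y z∉Y with lem (y ∈ₛ Y)
    ... | yes y∈Y = exit-edge w Y Z (w⊆Z ∘ there) y∈Y z∉Y
    ... | no y∉Y  = _ , y , x∈Y , w⊆Z (there (source∈vertices w)) , y∉Y , e

    walk⇒reach : ∀ {x y k} → Walk x y k → Reach x y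
    walk⇒reach w = Z , ∈-deduplicate⁺ _≟B_ (source∈vertices w) ,
                   λ Y (x∈Y , y∉Y , no-exit) → no-exit (exit-edge w Y Z (∈-deduplicate⁺ _≟B_) x∈Y y∉Y)
      where
      _≟B_ : (a b : B) → Dec (a ≡ b)
      a ≟B b = lem (a ≡ b)
      Z : FinSet B
      Z = deduplicate _≟B_ (vertices w) , UniqueDec.deduplicate-! _≟B_ (vertices w)

    walk⁺⇒reach⁺ : ∀ {x y} → Walk⁺ x y → Reach⁺ x y
    walk⁺⇒reach⁺ (_ , e ◅ w) = _ , e , walk⇒reach w

    noCycle⇒acyclic : NoCycle → Acyclic
    noCycle⇒acyclic noCycle (_ , e ◅ w) = noCycle _ _ (e , walk⇒reach w)

    walks-bounded : Acyclic → BoundedIntervals → ∀ x y → ∃[ N ] (∀ {k} → Walk x y k → k < N)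
    walks-bounded acyclic bounded x y = N , λ w →
      subst (_≤ N) (length-vertices w)
        (bound (vertices w , vertices-unique acyclic w) (chain w , between w))
      where
      N = proj₁ (bounded x y)
      bound = proj₂ (bounded x y)

      chain : ∀ {k} (w : Walk x y k) → Chain (vertices w , vertices-unique acyclic w)
      chain w p q (p∈w , q∈w , incomparable) with vertices-comparable w p∈w q∈w
      ... | inj₁ p≡q          = incomparable (inj₁ p≡q)
      ... | inj₂ (inj₁ p⇝q)   = incomparable (inj₂ (inj₁ (walk⁺⇒reach⁺ p⇝q)))
      ... | inj₂ (inj₂ q⇝p)   = incomparable (inj₂ (inj₂ (walk⁺⇒reach⁺ q⇝p)))

      between : ∀ {k} (w : Walk x y k) → Between x y (vertices w , vertices-unique acyclic w)
      between w p (p∈w , unreachable) with split-at w p∈w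
      ... | (_ , x⇝p) , (_ , p⇝y) = unreachable (walk⇒reach x⇝p , walk⇒reach p⇝y)

-- Necessity: the conditions hold along a strictly monotone map to ℤ

module Monotone {B : Set} {E : B → B → Set} (h : B → ℤ) (h-mono : ∀ {a b} → E a b → h a <ℤ h b) where
  open Digraph E

  -- The vertices of Z above h v form a set that no edge leaves within Z.
  reach⇒≤ : ∀ {u v} → Reach u v → h u ≤ℤ h v
  reach⇒≤ {u} {v} ((zs , unique-zs) , u∈Z , closed) with h u ≤ℤ? h v
  ... | yes hu≤hv = hu≤hv
  ... | no hu≰hv  = ⊥-elim (closed Y (∈-filter⁺ above? u∈Z (ℤ.≰⇒> hu≰hv) , v∉Y , no-exit))
    where
    above? = λ z → h v <ℤ? h z
    Y : FinSet B
    Y = filter above? zs , filter⁺ above? unique-zs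
    v∉Y : ¬ v ∈ₛ Y
    v∉Y v∈Y = ℤ.<-irrefl refl (proj₂ (∈-filter⁻ above? {xs = zs} v∈Y))
    no-exit : ¬ ExitEdge Y (zs , unique-zs)
    no-exit (a , b , a∈Y , b∈Z , b∉Y , e) =
      b∉Y (∈-filter⁺ above? b∈Z (ℤ.<-trans (proj₂ (∈-filter⁻ above? {xs = zs} a∈Y)) (h-mono e)))

  reach⁺⇒< : ∀ {u v} → Reach⁺ u v → h u <ℤ h v
  reach⁺⇒< (_ , e , r) = ℤ.<-≤-trans (h-mono e) (reach⇒≤ r)

  noCycle : NoCycle
  noCycle u v (e , r) = ℤ.<⇒≱ (h-mono e) (reach⇒≤ r)

  boundedIntervals : LEM → BoundedIntervals
  boundedIntervals lem x y = suc ∣ h x - h y ∣ , λ (xs , unique-xs) (chain , between) →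
    length≤-of-injection-into-interval unique-xs h
      (λ p∈X → bounds (decidable-stable (lem _) (λ ¬r → between _ (p∈X , ¬r))))
      (λ p∈X q∈X hp≡hq → decidable-stable (lem _)
         (λ p≢q → chain _ _ (p∈X , q∈X , [ p≢q , [ <-contra hp≡hq , <-contra (sym hp≡hq) ] ])))
    where
    bounds : ∀ {p} → Reach x p × Reach p y → h x ≤ℤ h p × h p ≤ℤ h y
    bounds (x⇝p , p⇝y) = reach⇒≤ x⇝p , reach⇒≤ p⇝y
    <-contra : ∀ {p q} → h p ≡ h q → ¬ Reach⁺ p q
    <-contra hp≡hq = ℤ.<-irrefl hp≡hq ∘ reach⁺⇒<

-- Sufficiency: building a strictly monotone map to ℤ along an enumeration

module Potential {B : Set} (E : B → B → Set) (lem : LEM)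
                 (c : B → ℕ) (c-injective : Injective _≡_ _≡_ c) where
  open Digraph E

  below-suc : ∀ {y b n} → c y ≡ n → c b < suc n → c b < n ⊎ b ≡ y
  below-suc cy≡n cb<1+n = map₂ (λ cb≡n → c-injective (trans cb≡n (sym cy≡n))) (m<1+n⇒m<n∨m≡n cb<1+n)

  below-suc-absent : ∀ {b n} → ¬ (∃[ y ] c y ≡ n) → c b < suc n → c b < n
  below-suc-absent absent cb<1+n = [ (λ cb<n → cb<n) , (λ cb≡n → ⊥-elim (absent (_ , cb≡n))) ]
                                     (m<1+n⇒m<n∨m≡n cb<1+n)

  ⋃-below : ∀ {A : Set} → ℕ → (B → Pred A 0ℓ) → Pred A 0ℓ
  ⋃-below n Q z = ∃[ b ] c b < n × Q b z

  greatestOrEmpty-⋃-below : ∀ {A : Set} {_≼_ : Rel A 0ℓ} {Q : B → Pred A 0ℓ} →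
                            Transitive _≼_ → Total _≼_ → (∀ b → GreatestOrEmpty _≼_ (Q b)) →
                            ∀ n → GreatestOrEmpty _≼_ (⋃-below n Q)
  greatestOrEmpty-⋃-below _ _ _ zero = empty (λ { _ (_ , () , _) })
  greatestOrEmpty-⋃-below {Q = Q} ≼-trans ≼-total each (suc n)
    with lem (∃[ y ] c y ≡ n) | greatestOrEmpty-⋃-below ≼-trans ≼-total each n
  ... | no absent | previous = greatestOrEmpty-≐
        ( (λ (b , cb<n , q) → b , m<n⇒m<1+n cb<n , q)
        , (λ (b , cb<1+n , q) → b , below-suc-absent absent cb<1+n , q) )
        previous
  ... | yes (y , cy≡n) | previous = greatestOrEmpty-≐ (into , back)
        (greatestOrEmpty-∪ ≼-trans ≼-total previous (each y))
    where
    into : ∀ {z} → (⋃-below n Q ∪ Q y) z → ⋃-below (suc n) Q z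
    into (inj₁ (b , cb<n , q)) = b , m<n⇒m<1+n cb<n , q
    into (inj₂ q)              = y , subst (_< suc n) (sym cy≡n) (n<1+n n) , q
    back : ∀ {z} → ⋃-below (suc n) Q z → (⋃-below n Q ∪ Q y) z
    back (b , cb<1+n , q) with below-suc cy≡n cb<1+n
    ... | inj₁ cb<n = inj₁ (b , cb<n , q)
    ... | inj₂ refl = inj₂ q

  Consistent : ℕ → (B → ℤ) → Set
  Consistent n g = ∀ {a b k} → c a < n → c b < n → Walk a b k → g a + + k ≤ℤ g b

  Placement : ℕ → (B → ℤ) → B → ℤ → Set
  Placement n g y v = (∀ {b k} → c b < n → Walk b y k → g b + + k ≤ℤ v)
                    × (∀ {b k} → c b < n → Walk y b k → v + + k ≤ℤ g b)

  _[_≔_] : (B → ℤ) → ℕ → ℤ → B → ℤ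
  (g [ n ≔ v ]) b with c b ≟ n
  ... | yes _ = v
  ... | no _  = g b

  update-here : ∀ {g n v b} → c b ≡ n → (g [ n ≔ v ]) b ≡ v
  update-here {n = n} {b = b} cb≡n with c b ≟ n
  ... | yes _    = refl
  ... | no cb≢n  = ⊥-elim (cb≢n cb≡n)

  update-elsewhere : ∀ {g n v b} → c b ≢ n → (g [ n ≔ v ]) b ≡ g b
  update-elsewhere {n = n} {b = b} cb≢n with c b ≟ n
  ... | yes cb≡n = ⊥-elim (cb≢n cb≡n)
  ... | no _     = refl

  module _ (acyclic : Acyclic) (bounded : BoundedIntervals) where

    longest-walk : ∀ x y → GreatestOrEmpty _≤_ (Walk x y)
    longest-walk x y with walks-bounded lem acyclic bounded x y
    ... | N , walk<N = greatestOrEmpty-bounded lem N walk<N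

    -- Put y at the greatest lower constraint g b₀ + k₀; a successor b of y then lies at
    -- the end of a walk from b₀, so consistency of g already bounds it.
    placement : ∀ {n g} → Consistent n g → ∀ y → ∃ (Placement n g y)
    placement {n} {g} consistent y with lower | upper
      where
      lower = greatestOrEmpty-⋃-below ℤ.≤-trans ℤ.≤-total
                (λ b → greatestOrEmpty-image (λ k → g b + + k)
                         (λ k≤l → ℤ.+-monoʳ-≤ (g b) (+≤+ k≤l)) (longest-walk b y)) n
      upper = greatestOrEmpty-⋃-below {_≼_ = _≥ℤ_} (Flip.trans _≤ℤ_ ℤ.≤-trans) (Flip.total _≤ℤ_ ℤ.≤-total)
                (λ b → greatestOrEmpty-image (λ k → g b - + k)
                         (λ k≤l → ℤ.+-monoʳ-≤ (g b) (ℤ.neg-mono-≤ (+≤+ k≤l))) (longest-walk y b)) n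
    ... | greatest ℓ (b₀ , cb₀<n , k₀ , w₀ , refl) ℓ-max | _ =
      ℓ , (λ cb<n w → ℓ-max (_ , cb<n , _ , w , refl)) , successor
      where
      open ℤ.≤-Reasoning
      successor : ∀ {b k} → c b < n → Walk y b k → g b₀ + + k₀ + + k ≤ℤ g b
      successor {b} {k} cb<n w = begin
        g b₀ + + k₀ + + k     ≡⟨ ℤ.+-assoc (g b₀) (+ k₀) (+ k) ⟩
        g b₀ + (+ k₀ + + k)   ≡⟨ cong (_+_ (g b₀)) (sym (ℤ.pos-+ k₀ k)) ⟩
        g b₀ + + (k₀ +ℕ k)    ≤⟨ consistent cb₀<n cb<n (w₀ ◅◅ w) ⟩
        g b                   ∎
    ... | empty no-lower | greatest u _ u-least =
      u , (λ cb<n w → ⊥-elim (no-lower _ (_ , cb<n , _ , w , refl))) ,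
      λ {b} {k} cb<n w → subst (u + + k ≤ℤ_) (//-rightDividesˡ (+ k) (g b))
                           (ℤ.+-monoˡ-≤ (+ k) (u-least (_ , cb<n , _ , w , refl)))
    ... | empty no-lower | empty no-upper =
      0ℤ , (λ cb<n w → ⊥-elim (no-lower _ (_ , cb<n , _ , w , refl))) ,
           (λ cb<n w → ⊥-elim (no-upper _ (_ , cb<n , _ , w , refl)))

    update-consistent : ∀ {n g y v} → c y ≡ n → Consistent n g → Placement n g y v →
                        Consistent (suc n) (g [ n ≔ v ])
    update-consistent {n} {g} {y} {v} cy≡n consistent (lower , upper) {a} {b} {k} ca cb w
      with below-suc cy≡n ca | below-suc cy≡n cb
    ... | inj₁ ca<n | inj₁ cb<n
      rewrite update-elsewhere {g} {v = v} (<⇒≢ ca<n) | update-elsewhere {g} {v = v} (<⇒≢ cb<n)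
      = consistent ca<n cb<n w
    ... | inj₁ ca<n | inj₂ refl
      rewrite update-elsewhere {g} {v = v} (<⇒≢ ca<n) | update-here {g} {v = v} cy≡n
      = lower ca<n w
    ... | inj₂ refl | inj₁ cb<n
      rewrite update-here {g} {v = v} cy≡n | update-elsewhere {g} {v = v} (<⇒≢ cb<n)
      = upper cb<n w
    ... | inj₂ refl | inj₂ refl
      rewrite update-here {g} {v = v} cy≡n | closed-walk-length acyclic w
      = ℤ.≤-reflexive (ℤ.+-identityʳ v)

    extend : ∀ {n g} → Consistent n g → Σ (B → ℤ) (Consistent (suc n))
    extend {n} {g} consistent with lem (∃[ y ] c y ≡ n)
    ... | no absent = g , λ ca cb → consistent (below-suc-absent absent ca) (below-suc-absent absent cb)
    ... | yes (y , cy≡n) with placement consistent y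
    ...   | v , placed = g [ n ≔ v ] , update-consistent cy≡n consistent placed

    extend-elsewhere : ∀ {n g b} (consistent : Consistent n g) → c b ≢ n →
                       proj₁ (extend consistent) b ≡ g b
    extend-elsewhere {n} consistent cb≢n with lem (∃[ y ] c y ≡ n)
    ... | no _ = refl
    ... | yes (y , _) with placement consistent y
    ...   | _ = update-elsewhere cb≢n

    approximation : ∀ n → Σ (B → ℤ) (Consistent n)
    approximation zero    = (λ _ → 0ℤ) , λ ()
    approximation (suc n) = extend (proj₂ (approximation n))

    potential : B → ℤ
    potential b = proj₁ (approximation (suc (c b))) b

    approximation-stable : ∀ {n b} → c b < n → proj₁ (approximation n) b ≡ potential b
    approximation-stable {suc n} cb<1+n with m<1+n⇒m<n∨m≡n cb<1+n
    ... | inj₁ cb<n = trans (extend-elsewhere (proj₂ (approximation n)) (<⇒≢ cb<n))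
                            (approximation-stable cb<n)
    ... | inj₂ refl = refl

    potential-mono : ∀ {a b} → E a b → potential a <ℤ potential b
    potential-mono {a} {b} e = ℤ.suc[i]≤j⇒i<j
      (subst₂ _≤ℤ_ (trans (ℤ.+-comm (proj₁ (approximation N) a) (+ 1))
                          (cong (_+_ (+ 1)) (approximation-stable ca<N)))
                   (approximation-stable cb<N)
                   (proj₂ (approximation N) ca<N cb<N (e ◅ ε)))
      where
      N = suc (c a +ℕ c b)
      ca<N : c a < N
      ca<N = s≤s (m≤m+n (c a) (c b))
      cb<N : c b < N
      cb<N = s≤s (m≤n+m (c b) (c a))

module _ {B : Set} (E : B → B → Set) where
  open Digraph E

  monotone⇔conditions : LEM → (c : B → ℕ) → Injective _≡_ _≡_ c →
                        (∃[ h ] (∀ {a b} → E a b → h a <ℤ h b)) ⇔ (NoCycle × BoundedIntervals)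
  monotone⇔conditions lem c c-injective = mk⇔
    (λ (h , h-mono) → let open Monotone h h-mono in noCycle , boundedIntervals lem)
    (λ (noCycle , bounded) → let open Potential E lem c c-injective
                                 acyclic = noCycle⇒acyclic lem noCycle
                             in potential acyclic bounded , potential-mono acyclic bounded)

module Sentences {Symb : Set} (s : Symb) where

  reach : ∀ {n m} → Fin n → Fin n → Fml Symb n m
  reach u v = ex₂ (and (mem u zero) (all₂ (not (and (mem u zero) (and (not (mem v zero))
               (not (ex₁ (ex₁ (and (mem (suc zero) zero) (and (mem zero (suc zero))
                 (and (not (mem zero zero)) (atom s (suc zero) zero))))))))))))

  reach⁺ : ∀ {n m} → Fin n → Fin n → Fml Symb n m
  reach⁺ p q = ex₁ (and (atom s (suc p) zero) (reach zero (suc q)))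

  noCycle : Sentence Symb
  noCycle = all₁ (all₁ (not (and (atom s (suc zero) zero) (reach zero (suc zero)))))

  chain : Fml Symb 2 1
  chain = all₁ (all₁ (not (and (mem (suc zero) zero) (and (mem zero zero)
            (not (or (eq (suc zero) zero) (or (reach⁺ (suc zero) zero) (reach⁺ zero (suc zero)))))))))

  between : Fml Symb 2 1
  between = all₁ (not (and (mem zero zero)
              (not (and (reach (suc (suc zero)) zero) (reach zero (suc zero))))))

  boundedIntervals : Sentence Symb
  boundedIntervals = all₁ (all₁ (bnd (and chain between)))

  φ< : Sentence Symb
  φ< = and noCycle boundedIntervals

  satisfies-φ< : (𝔅 : Structure Symb) →
                 (𝔅 ⊨ φ<) ⇔ (Digraph.NoCycle (rel 𝔅 s) × Digraph.BoundedIntervals (rel 𝔅 s))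
  satisfies-φ< 𝔅 = ⇔.refl

tautology : ∀ {Symb} → Sentence Symb
tautology = all₁ (eq zero zero)

symbol? : (σ : SubSig ⊤) → Dec (Sym σ)
symbol? σ = map′ (tt ,_) proj₂ (T? (σ tt))

sentence : (σ : SubSig ⊤) → Dec (Sym σ) → Sentence (Sym σ)
sentence σ (yes s) = Sentences.φ< s
sentence σ (no _)  = tautology

symbol-unique : ∀ {σ : SubSig ⊤} (s s′ : Sym σ) → s ≡ s′
symbol-unique (tt , p) (tt , q) = cong (tt ,_) (T-irrelevant p q)

⪯ℤ<⇔monotone : ∀ {σ} (s : Sym σ) (𝔅 : Structure (Sym σ)) →
               (𝔅 ⪯ reduct σ ℤ<) ⇔ (∃[ h ] (∀ {a b} → rel 𝔅 s a b → h a <ℤ h b))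
⪯ℤ<⇔monotone s 𝔅 = mk⇔
  (λ (h , hom) → h , hom s _ _)
  (λ (h , mono) → h , λ s′ a b → mono ∘ subst (λ t → rel 𝔅 t a b) (symbol-unique s′ s))

proposition2 : EHomDef-WMSOB ℤ<
proposition2 = (λ σ → sentence σ (symbol? σ)) , defines
  where
  defines : LEM → (σ : SubSig ⊤) (𝔅 : Structure (Sym σ)) → Countable 𝔅 →
            (𝔅 ⪯ reduct σ ℤ<) ⇔ (𝔅 ⊨ sentence σ (symbol? σ))
  defines lem σ 𝔅 (c , c-injective) with symbol? σ
  ... | yes s = ⇔.trans (⪯ℤ<⇔monotone s 𝔅)
                  (⇔.trans (monotone⇔conditions (rel 𝔅 s) lem c c-injective)
                           (⇔.sym (Sentences.satisfies-φ< s 𝔅)))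
  ... | no no-symbol = mk⇔ (λ _ _ → refl) (λ _ → (λ _ → 0ℤ) , λ s → ⊥-elim (no-symbol s))
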